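{- Let $G$ be a finite undirected graph with two distinct vertices $s,t$, and suppose $G$ contains a split gadget $S_k$ ($k\ge 2$, as defined in the context) none of whose vertices is $s$ or $t$. In any non-transitive $st$-orientation of $G$: if the input edge of $S_k$ is oriented entering $S_k$, then all $k$ output edges of $S_k$ are oriented exiting $S_k$; if the input edge is oriented exiting $S_k$, then all $k$ output edges are oriented entering $S_k$.
   Context: An $st$-orientation of $G$ is an assignment of a direction to each edge such that the resulting digraph is acyclic with $s$ as unique source and $t$ as unique sink. An edge directed from $u$ to $v$ is transitive if there is a directed path from $u$ to $v$ avoiding that edge; the orientation is non-transitive if no edge is transitive. A fork structure on six distinct vertices $v,a,b,c,w,z$ consists of the edges $(v,a),(v,b),(v,c),(a,w),(b,w),(b,z),(c,z)$. A split gadget $S_k$ consists of $k-1$ fork structures on pairwise distinct vertex sets $\{v_i,a_i,b_i,c_i,w_i,z_i\}$, $i=1,\dots,k-1$, together with the edges $(w_i,v_{i+1})$ for $i=1,\dots,k-2$, an input edge $(p,v_1)$, and output edges $(z_i,r_i)$ for $i=1,\dots,k-1$ and $(w_{k-1},q)$, where $p,q,r_1,\dots,r_{k-1}$ are vertices outside the gadget; the gadget's vertices have no incident edges in $G$ other than these. An edge joining a gadget vertex $y$ to an outside vertex $y'$ is oriented entering $S_k$ if directed from $y'$ to $y$, and exiting otherwise. -}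

module Defs where

open import Data.Nat using (ℕ; suc)
open import Data.Fin using (Fin; zero; suc; inject₁; fromℕ)
open import Data.Product using (Σ; _×_; ∃; ∃-syntax)
open import Data.Sum using (_⊎_)
open import Relation.Nullary using (¬_)
open import Relation.Binary.PropositionalEquality using (_≡_; _≢_)
open import Relation.Binary.Construct.Closure.Transitive using (TransClosure)

record Graph (n : ℕ) : Set₁ where
  field
    Adj     : Fin n → Fin n → Set
    sym     : ∀ {x y} → Adj x y → Adj y x
    irrefl  : ∀ {x} → ¬ Adj x x
open Graph public

record IsOrientation {n : ℕ} (G : Graph n) (O : Fin n → Fin n → Set) : Set where
  field
    onEdges  : ∀ {u v} → O u v → Adj G u v
    total    : ∀ {u v} → Adj G u v → O u v ⊎ O v u
    antisym  : ∀ {u v} → O u v → ¬ O v u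

-- Directed path (of length ≥ 1) in the digraph O.
Path : {n : ℕ} → (Fin n → Fin n → Set) → Fin n → Fin n → Set
Path O = TransClosure O

Acyclic : {n : ℕ} → (Fin n → Fin n → Set) → Set
Acyclic {n} O = ∀ (x : Fin n) → ¬ Path O x x

IsSource : {n : ℕ} → (Fin n → Fin n → Set) → Fin n → Set
IsSource {n} O x = ∀ (y : Fin n) → ¬ O y x

IsSink : {n : ℕ} → (Fin n → Fin n → Set) → Fin n → Set
IsSink {n} O x = ∀ (y : Fin n) → ¬ O x y

record IsSTOrientation {n : ℕ} (G : Graph n) (s t : Fin n) (O : Fin n → Fin n → Set) : Set where
  field
    orientation  : IsOrientation G O
    acyclic      : Acyclic O
    s-source     : IsSource O s
    s-unique     : ∀ x → IsSource O x → x ≡ s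
    t-sink       : IsSink O t
    t-unique     : ∀ x → IsSink O x → x ≡ t

Without : {n : ℕ} → (Fin n → Fin n → Set) → Fin n → Fin n → Fin n → Fin n → Set
Without O u v x y = O x y × ¬ (x ≡ u × y ≡ v)

IsTransitiveEdge : {n : ℕ} → (Fin n → Fin n → Set) → Fin n → Fin n → Set
IsTransitiveEdge O u v = O u v × Path (Without O u v) u v

NonTransitive : {n : ℕ} → (Fin n → Fin n → Set) → Set
NonTransitive {n} O = ∀ (u v : Fin n) → ¬ IsTransitiveEdge O u v

-- Roles of the six vertices of a fork structure (v,a,b,c,w,z).
data Role : Set where
  V A B C W Z : Role

-- Vertex data of a split gadget S_k with k = suc (suc l): the k-1 = suc l forks
-- are indexed by Fin (suc l); fork i has vertices vert ρ i.
record GadgetData (n l : ℕ) : Set where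
  field
    vert : Role → Fin (suc l) → Fin n
    p    : Fin n
    q    : Fin n
    r    : Fin (suc l) → Fin n
open GadgetData public

module _ {n l : ℕ} (S : GadgetData n l) where
  gv ga gb gc gw gz : Fin (suc l) → Fin n
  gv = vert S V
  ga = vert S A
  gb = vert S B
  gc = vert S C
  gw = vert S W
  gz = vert S Z

  first last : Fin (suc l)
  first = zero
  last  = fromℕ l

  IsGadgetVertex : Fin n → Set
  IsGadgetVertex x = ∃[ ρ ] ∃[ i ] (vert S ρ i ≡ x)

  Outside : Fin n → Set
  Outside x = ∀ ρ i → vert S ρ i ≢ x

  -- The edges of the gadget (each listed once, with the orientation of the paper's notation).
  data GEdge : Fin n → Fin n → Set where
    va : ∀ i → GEdge (gv i) (ga i)
    vb : ∀ i → GEdge (gv i) (gb i)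
    vc : ∀ i → GEdge (gv i) (gc i)
    aw : ∀ i → GEdge (ga i) (gw i)
    bw : ∀ i → GEdge (gb i) (gw i)
    bz : ∀ i → GEdge (gb i) (gz i)
    cz : ∀ i → GEdge (gc i) (gz i)
    chain : ∀ (i : Fin l) → GEdge (gw (inject₁ i)) (gv (suc i))
    input : GEdge (p S) (gv first)
    outZ : ∀ i → GEdge (gz i) (r S i)
    outW : GEdge (gw last) (q S)

record IsSplitGadget {n l : ℕ} (G : Graph n) (S : GadgetData n l) : Set where
  field
    distinct   : ∀ ρ i σ j → vert S ρ i ≡ vert S σ j → ρ ≡ σ × i ≡ j
    p-outside  : Outside S (p S)
    q-outside  : Outside S (q S)
    r-outside  : ∀ i → Outside S (r S i)
    edges      : ∀ {x y} → GEdge S x y → Adj G x y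
    no-other   : ∀ {x y} → IsGadgetVertex S x → Adj G x y → GEdge S x y ⊎ GEdge S y x

{-# OPTIONS --safe #-}
-- The only vertices of degree two in a fork are a and c, so each of them lies on a
-- directed path v → · → w/z or w/z → · → v. If v is entered from the outside, an
-- upward path through a or c would force, together with the orientation of the
-- edges at b, either a directed 4-cycle, a transitive edge, or a sink at v; so both
-- paths go down, and then b → w and b → z for the same reasons. Now w and z are
-- entered on all their gadget edges and are not sinks, so their unique exits point
-- away from the fork, and the exit of w enters the next fork. Reversing every edge
-- preserves all hypotheses, which gives the second half.
module Submission where

open import Defs hiding (sym)
open import Data.Nat using (ℕ; suc)
open import Data.Fin using (Fin; zero; suc; inject₁)
open import Data.Fin.Induction using (<-weakInduction)
open import Data.Fin.Properties using (inject₁-injective; fromℕ≢inject₁)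
open import Data.Product using (_×_; _,_; proj₁; proj₂; ∃-syntax)
open import Data.Sum using (_⊎_; inj₁; inj₂)
open import Data.Empty using (⊥; ⊥-elim)
open import Function using (flip)
open import Relation.Nullary using (¬_)
open import Relation.Binary.PropositionalEquality using (_≡_; _≢_; refl; sym; trans)
open import Relation.Binary.Construct.Closure.Transitive using (TransClosure; [_]; _∷_; _∷ʳ_)

reverseMap : ∀ {A : Set} {R R′ : A → A → Set} → (∀ {x y} → R x y → R′ y x) →
             ∀ {x y} → TransClosure R x y → TransClosure R′ y x
reverseMap f [ r ]    = [ f r ]
reverseMap f (r ∷ rs) = reverseMap f rs ∷ʳ f r

private variable
  n : ℕ
  G : Graph n
  O : Fin n → Fin n → Set
  v a b c w z : Fin n

flip-orientation : IsOrientation G O → IsOrientation G (flip O)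
flip-orientation {G = G} isO = record
  { onEdges = λ o → Graph.sym G (onEdges o)
  ; total   = λ e → Data.Sum.swap (total e)
  ; antisym = λ o o′ → antisym o o′
  }
  where open IsOrientation isO

module _ (isO : IsOrientation G O) where
  open IsOrientation isO

  all-in⇒sink : ∀ {x} → (∀ {y} → Adj G x y → O y x) → IsSink O x
  all-in⇒sink all-in y o = antisym o (all-in (onEdges o))

  forced-successor : ∀ {x y} → Adj G x y → ¬ IsSink O x → (∀ {z} → O x z → z ≡ y) → O x y
  forced-successor {x} {y} xy ¬sink only-y with total xy
  ... | inj₁ x→y = x→y
  ... | inj₂ y→x = ⊥-elim (¬sink sink)
    where
    sink : IsSink O x
    sink z x→z with refl ← only-y x→z = antisym x→z y→x

module _ (isO : IsOrientation G O) where
  open IsOrientation isO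

  forced-predecessor : ∀ {x y} → Adj G x y → ¬ IsSource O x → (∀ {z} → O z x → z ≡ y) → O y x
  forced-predecessor = forced-successor (flip-orientation isO)

  degree-two-traversed : ∀ {x u w} → ¬ IsSource O x → ¬ IsSink O x →
                         Adj G x u → Adj G x w → (∀ {y} → Adj G x y → y ≡ u ⊎ y ≡ w) →
                         (O u x × O x w) ⊎ (O w x × O x u)
  degree-two-traversed {x} {u} {w} ¬source ¬sink xu xw neighbours with total xu
  ... | inj₂ u→x = inj₁ (u→x , forced-successor isO xw ¬sink only-w)
    where
    only-w : ∀ {y} → O x y → y ≡ w
    only-w x→y with neighbours (onEdges x→y)
    ... | inj₁ refl = ⊥-elim (antisym x→y u→x)
    ... | inj₂ y≡w  = y≡w
  ... | inj₁ x→u = inj₂ (forced-predecessor xw ¬source only-w , x→u)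
    where
    only-w : ∀ {y} → O y x → y ≡ w
    only-w y→x with neighbours (Graph.sym G (onEdges y→x))
    ... | inj₁ refl = ⊥-elim (antisym y→x x→u)
    ... | inj₂ y≡w  = y≡w

flip-acyclic : Acyclic O → Acyclic (flip O)
flip-acyclic acyclic x cycle = acyclic x (reverseMap (λ o → o) cycle)

flip-nonTransitive : NonTransitive O → NonTransitive (flip O)
flip-nonTransitive nonTransitive u v (v→u , detour) =
  nonTransitive v u (v→u , reverseMap (λ (o , ≢uv) → o , λ (y≡v , x≡u) → ≢uv (x≡u , y≡v)) detour)

-- No step of the path can be the shortcut itself, since that would close a cycle.
no-shortcut : Acyclic O → NonTransitive O → ∀ {x y z u} →
              O x y → O y z → O z u → ¬ O x u
no-shortcut {O = O} acyclic nonTransitive {x} {y} {z} {u} x→y y→z z→u x→u =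
  nonTransitive x u (x→u , (x→y , step₁) ∷ (y→z , step₂) ∷ [ z→u , step₃ ])
  where
  step₁ : ¬ (x ≡ x × y ≡ u)
  step₁ (_ , refl) = acyclic y (y→z ∷ [ z→u ])
  step₂ : ¬ (y ≡ x × z ≡ u)
  step₂ (refl , _) = acyclic y [ x→y ]
  step₃ : ¬ (z ≡ x × u ≡ u)
  step₃ (refl , _) = acyclic z (x→y ∷ [ y→z ])

record ForkShape (O : Fin n → Fin n → Set) (v a b c w z : Fin n) : Set where
  field
    a-route    : (O v a × O a w) ⊎ (O w a × O a v)
    c-route    : (O v c × O c z) ⊎ (O z c × O c v)
    vb-edge    : O v b ⊎ O b v
    bw-edge    : O b w ⊎ O w b
    bz-edge    : O b z ⊎ O z b
    v-not-sink : O a v → O b v → O c v → ⊥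

mirror : ForkShape O v a b c w z → ForkShape O v c b a z w
mirror F = record
  { a-route    = c-route
  ; c-route    = a-route
  ; vb-edge    = vb-edge
  ; bw-edge    = bz-edge
  ; bz-edge    = bw-edge
  ; v-not-sink = λ c→v b→v a→v → v-not-sink a→v b→v c→v
  }
  where open ForkShape F

module _ (acyclic : Acyclic O) (nonTransitive : NonTransitive O) where

  a-not-upward : ForkShape O v a b c w z → O w a → O a v → ⊥
  a-not-upward F w→a a→v with ForkShape.vb-edge F | ForkShape.bw-edge F
  ... | inj₁ v→b | inj₁ b→w = acyclic _ (v→b ∷ b→w ∷ w→a ∷ [ a→v ])
  ... | inj₁ v→b | inj₂ w→b = no-shortcut acyclic nonTransitive w→a a→v v→b w→b
  ... | inj₂ b→v | _ with ForkShape.c-route F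
  ...   | inj₂ (_ , c→v) = ForkShape.v-not-sink F a→v b→v c→v
  ...   | inj₁ (v→c , c→z) with ForkShape.bz-edge F
  ...     | inj₁ b→z = no-shortcut acyclic nonTransitive b→v v→c c→z b→z
  ...     | inj₂ z→b = acyclic _ (z→b ∷ b→v ∷ v→c ∷ [ c→z ])

  a-downward : ForkShape O v a b c w z → O v a × O a w
  a-downward F with ForkShape.a-route F
  ... | inj₁ down         = down
  ... | inj₂ (w→a , a→v) = ⊥-elim (a-not-upward F w→a a→v)

  b-enters-w : ForkShape O v a b c w z → O b w
  b-enters-w F with ForkShape.bw-edge F | ForkShape.vb-edge F | a-downward F
  ... | inj₁ b→w | _        | _         = b→w
  ... | inj₂ w→b | inj₁ v→b | v→a , a→w = ⊥-elim (no-shortcut acyclic nonTransitive v→a a→w w→b v→b)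
  ... | inj₂ w→b | inj₂ b→v | v→a , a→w = ⊥-elim (acyclic _ (w→b ∷ b→v ∷ v→a ∷ [ a→w ]))

  fork-flows-down : ForkShape O v a b c w z → (O a w × O b w) × (O b z × O c z)
  fork-flows-down F =
      (proj₂ (a-downward F) , b-enters-w F)
    , (b-enters-w (mirror F) , proj₂ (a-downward (mirror F)))

record Admissible {n l : ℕ} (G : Graph n) (S : GadgetData n l) (O : Fin n → Fin n → Set) : Set where
  field
    orientation   : IsOrientation G O
    acyclic       : Acyclic O
    nonTransitive : NonTransitive O
    not-source    : ∀ ρ i → ¬ IsSource O (vert S ρ i)
    not-sink      : ∀ ρ i → ¬ IsSink O (vert S ρ i)

flip-admissible : ∀ {l} {S : GadgetData n l} → Admissible G S O → Admissible G S (flip O)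
flip-admissible adm = record
  { orientation   = flip-orientation orientation
  ; acyclic       = flip-acyclic acyclic
  ; nonTransitive = flip-nonTransitive nonTransitive
  ; not-source    = not-sink
  ; not-sink      = not-source
  }
  where open Admissible adm

st-admissible : ∀ {l} {S : GadgetData n l} {s t} →
                ¬ IsGadgetVertex S s → ¬ IsGadgetVertex S t →
                IsSTOrientation G s t O → NonTransitive O → Admissible G S O
st-admissible s∉S t∉S st nonTransitive = record
  { orientation   = orientation
  ; acyclic       = acyclic
  ; nonTransitive = nonTransitive
  ; not-source    = λ ρ i source → s∉S (ρ , i , s-unique _ source)
  ; not-sink      = λ ρ i sink → t∉S (ρ , i , t-unique _ sink)
  }
  where open IsSTOrientation st

module _ {n l : ℕ} {G : Graph n} {S : GadgetData n l} (gadget : IsSplitGadget G S) where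
  open IsSplitGadget gadget

  -- Neighbours of vert S ρ i, split by the direction in which GEdge lists the edge (not by O).
  Pred : Role → Fin (suc l) → Fin n → Set
  Pred V i x = (i ≡ first S × x ≡ p S) ⊎ (∃[ j ] (suc j ≡ i × x ≡ gw S (inject₁ j)))
  Pred A i x = x ≡ gv S i
  Pred B i x = x ≡ gv S i
  Pred C i x = x ≡ gv S i
  Pred W i x = x ≡ ga S i ⊎ x ≡ gb S i
  Pred Z i x = x ≡ gb S i ⊎ x ≡ gc S i

  Succ : Role → Fin (suc l) → Fin n → Set
  Succ V i y = y ≡ ga S i ⊎ y ≡ gb S i ⊎ y ≡ gc S i
  Succ A i y = y ≡ gw S i
  Succ B i y = y ≡ gw S i ⊎ y ≡ gz S i
  Succ C i y = y ≡ gz S i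
  Succ W i y = (∃[ j ] (inject₁ j ≡ i × y ≡ gv S (suc j))) ⊎ (i ≡ last S × y ≡ q S)
  Succ Z i y = y ≡ r S i

  GEdge⇒Pred : ∀ {ρ i x y} → GEdge S x y → y ≡ vert S ρ i → Pred ρ i x
  GEdge⇒Pred (va _) eq with refl , refl ← distinct _ _ _ _ eq = refl
  GEdge⇒Pred (vb _) eq with refl , refl ← distinct _ _ _ _ eq = refl
  GEdge⇒Pred (vc _) eq with refl , refl ← distinct _ _ _ _ eq = refl
  GEdge⇒Pred (aw _) eq with refl , refl ← distinct _ _ _ _ eq = inj₁ refl
  GEdge⇒Pred (bw _) eq with refl , refl ← distinct _ _ _ _ eq = inj₂ refl
  GEdge⇒Pred (bz _) eq with refl , refl ← distinct _ _ _ _ eq = inj₁ refl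
  GEdge⇒Pred (cz _) eq with refl , refl ← distinct _ _ _ _ eq = inj₂ refl
  GEdge⇒Pred (chain j) eq with refl , refl ← distinct _ _ _ _ eq = inj₂ (j , refl , refl)
  GEdge⇒Pred input eq with refl , refl ← distinct _ _ _ _ eq = inj₁ (refl , refl)
  GEdge⇒Pred (outZ i) eq = ⊥-elim (r-outside i _ _ (sym eq))
  GEdge⇒Pred outW eq = ⊥-elim (q-outside _ _ (sym eq))

  GEdge⇒Succ : ∀ {ρ i x y} → GEdge S x y → x ≡ vert S ρ i → Succ ρ i y
  GEdge⇒Succ (va _) eq with refl , refl ← distinct _ _ _ _ eq = inj₁ refl
  GEdge⇒Succ (vb _) eq with refl , refl ← distinct _ _ _ _ eq = inj₂ (inj₁ refl)
  GEdge⇒Succ (vc _) eq with refl , refl ← distinct _ _ _ _ eq = inj₂ (inj₂ refl)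
  GEdge⇒Succ (aw _) eq with refl , refl ← distinct _ _ _ _ eq = refl
  GEdge⇒Succ (bw _) eq with refl , refl ← distinct _ _ _ _ eq = inj₁ refl
  GEdge⇒Succ (bz _) eq with refl , refl ← distinct _ _ _ _ eq = inj₂ refl
  GEdge⇒Succ (cz _) eq with refl , refl ← distinct _ _ _ _ eq = refl
  GEdge⇒Succ (chain j) eq with refl , refl ← distinct _ _ _ _ eq = inj₁ (j , refl , refl)
  GEdge⇒Succ input eq = ⊥-elim (p-outside _ _ (sym eq))
  GEdge⇒Succ (outZ _) eq with refl , refl ← distinct _ _ _ _ eq = refl
  GEdge⇒Succ outW eq with refl , refl ← distinct _ _ _ _ eq = inj₂ (refl , refl)

  Adj⇒Pred⊎Succ : ∀ ρ i {y} → Adj G (vert S ρ i) y → Pred ρ i y ⊎ Succ ρ i y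
  Adj⇒Pred⊎Succ ρ i adj with no-other (ρ , i , refl) adj
  ... | inj₁ e = inj₂ (GEdge⇒Succ e refl)
  ... | inj₂ e = inj₁ (GEdge⇒Pred e refl)

  Succ-W-unique : ∀ {i y y′} → Succ W i y → Succ W i y′ → y ≡ y′
  Succ-W-unique (inj₁ (j , eq , refl)) (inj₁ (j′ , eq′ , refl))
    with refl ← inject₁-injective (trans eq (sym eq′)) = refl
  Succ-W-unique (inj₁ (_ , eq , _)) (inj₂ (eq′ , _)) = ⊥-elim (fromℕ≢inject₁ (sym (trans eq eq′)))
  Succ-W-unique (inj₂ (eq′ , _)) (inj₁ (_ , eq , _)) = ⊥-elim (fromℕ≢inject₁ (sym (trans eq eq′)))
  Succ-W-unique (inj₂ (_ , refl)) (inj₂ (_ , refl)) = refl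

  module _ {O : Fin n → Fin n → Set} (adm : Admissible G S O) where
    open Admissible adm
    open IsOrientation orientation

    Entered : Fin (suc l) → Set
    Entered i = ∀ {x} → Pred V i x → O x (gv S i)

    fork-shape : ∀ {i} → Entered i → ForkShape O (gv S i) (ga S i) (gb S i) (gc S i) (gw S i) (gz S i)
    fork-shape {i} entered = record
      { a-route    = degree-two-traversed orientation (not-source A i) (not-sink A i)
                       (Graph.sym G (edges (va i))) (edges (aw i)) (Adj⇒Pred⊎Succ A i)
      ; c-route    = degree-two-traversed orientation (not-source C i) (not-sink C i)
                       (Graph.sym G (edges (vc i))) (edges (cz i)) (Adj⇒Pred⊎Succ C i)
      ; vb-edge    = total (edges (vb i))
      ; bw-edge    = total (edges (bw i))
      ; bz-edge    = total (edges (bz i))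
      ; v-not-sink = λ a→v b→v c→v → not-sink V i (all-in⇒sink orientation (into-v a→v b→v c→v))
      }
      where
      into-v : O (ga S i) (gv S i) → O (gb S i) (gv S i) → O (gc S i) (gv S i) →
               ∀ {y} → Adj G (gv S i) y → O y (gv S i)
      into-v a→v b→v c→v adj with Adj⇒Pred⊎Succ V i adj
      ... | inj₁ pred                = entered pred
      ... | inj₂ (inj₁ refl)         = a→v
      ... | inj₂ (inj₂ (inj₁ refl))  = b→v
      ... | inj₂ (inj₂ (inj₂ refl))  = c→v

    w-exit : ∀ {i} → O (ga S i) (gw S i) → O (gb S i) (gw S i) →
             ∀ {y} → GEdge S (gw S i) y → O (gw S i) y
    w-exit {i} a→w b→w {y} e = forced-successor orientation (edges e) (not-sink W i) only-y
      where
      only-y : ∀ {y′} → O (gw S i) y′ → y′ ≡ y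
      only-y w→y′ with Adj⇒Pred⊎Succ W i (onEdges w→y′)
      ... | inj₁ (inj₁ refl) = ⊥-elim (antisym w→y′ a→w)
      ... | inj₁ (inj₂ refl) = ⊥-elim (antisym w→y′ b→w)
      ... | inj₂ succ        = Succ-W-unique succ (GEdge⇒Succ {W} {i} e refl)

    z-exit : ∀ {i} → O (gb S i) (gz S i) → O (gc S i) (gz S i) →
             ∀ {y} → GEdge S (gz S i) y → O (gz S i) y
    z-exit {i} b→z c→z {y} e = forced-successor orientation (edges e) (not-sink Z i) only-y
      where
      only-y : ∀ {y′} → O (gz S i) y′ → y′ ≡ y
      only-y z→y′ with Adj⇒Pred⊎Succ Z i (onEdges z→y′)
      ... | inj₁ (inj₁ refl) = ⊥-elim (antisym z→y′ b→z)
      ... | inj₁ (inj₂ refl) = ⊥-elim (antisym z→y′ c→z)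
      ... | inj₂ y′≡r        = trans y′≡r (sym (GEdge⇒Succ {Z} {i} e refl))

    fork-exits : ∀ {i} → Entered i →
                 (∀ {y} → GEdge S (gw S i) y → O (gw S i) y)
               × (∀ {y} → GEdge S (gz S i) y → O (gz S i) y)
    fork-exits entered
      with (a→w , b→w) , (b→z , c→z) ← fork-flows-down acyclic nonTransitive (fork-shape entered)
      = w-exit a→w b→w , z-exit b→z c→z

    entered-all : O (p S) (gv S (first S)) → ∀ i → Entered i
    entered-all p→v = <-weakInduction Entered entered-first entered-suc
      where
      entered-first : Entered zero
      entered-first (inj₁ (_ , refl))   = p→v
      entered-first (inj₂ (_ , () , _))
      entered-suc : ∀ j → Entered (inject₁ j) → Entered (suc j)
      entered-suc j entered (inj₁ (() , _))
      entered-suc j entered (inj₂ (_ , refl , refl)) = proj₁ (fork-exits entered) (chain j)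

    propagate : O (p S) (gv S (first S)) → (∀ i → O (gz S i) (r S i)) × O (gw S (last S)) (q S)
    propagate p→v = (λ i → proj₂ (fork-exits (entered i)) (outZ i))
                  , proj₁ (fork-exits (entered (last S))) outW
      where
      entered : ∀ i → Entered i
      entered = entered-all p→v

lemma3 : ∀ {n : ℕ} (G : Graph n) (s t : Fin n) → s ≢ t →
    ∀ (l : ℕ) (S : GadgetData n l) → IsSplitGadget G S →
    ¬ IsGadgetVertex S s → ¬ IsGadgetVertex S t →
    ∀ (O : Fin n → Fin n → Set) → IsSTOrientation G s t O → NonTransitive O →
    (O (p S) (gv S (first S)) →
       (∀ i → O (gz S i) (r S i)) × O (gw S (last S)) (q S))
    × (O (gv S (first S)) (p S) →
       (∀ i → O (r S i) (gz S i)) × O (q S) (gw S (last S)))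
lemma3 G s t _ l S gadget s∉S t∉S O st nonTransitive =
  propagate gadget admissible , propagate gadget (flip-admissible admissible)
  where
  admissible : Admissible G S O
  admissible = st-admissible s∉S t∉S st nonTransitive
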